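{- Let $\pi\in S_n$ and $S\in\mathrm{Sub}(\pi)$. If $S$ is valid, then $S$ is $\overrightarrow{P_2}$-free. In particular, $\left|\mathcal{O}^{ -1}_{\mathrm{MVP}_n}(\pi)\right|\le|\{S\in\mathrm{Sub}(\pi): S\text{ is }\overrightarrow{P_2}\text{ -free}\}|$.
   Context: Let $[n]=\{1,\dots,n\}$. A parking preference is $p\in[n]^n$. In the MVP parking process, cars $1,\dots,n$ enter in order a one-way street with spots $1,\dots,n$; car $i$ parks in spot $p_i$, and if $p_i$ was occupied by an earlier car $j$, car $j$ is bumped and parks in the first unoccupied spot $k>p_i$ (bumped cars do not bump others). $p$ is an MVP parking function if all cars park; $\mathrm{MVP}_n$ is the set of these. The outcome $\mathcal{O}_{\mathrm{MVP}_n}(p)$ is the permutation $\pi$ with $\pi_i$ the car in spot $i$ at the end; $\mathcal{O}^{ -1}_{\mathrm{MVP}_n}(\pi)$ is the set of MVP parking functions with outcome $\pi$. $\mathrm{Inv}(\pi)=\{(j,i):j<i,\ \pi_j>\pi_i\}$; $\mathrm{Sub}(\pi)$ is the set of $S\subseteq\mathrm{Inv}(\pi)$ such that each $i$ has at most one $j$ with $(j,i)\in S$. For $S\in\mathrm{Sub}(\pi)$, $\Psi_{\mathrm{Sub}\to\mathrm{PF}}(S)$ is the preference $p$ with $p_{\pi_i}=i$ if no $(j,i)\in S$ and $p_{\pi_i}=j$ if $(j,i)\in S$; $S$ is valid if $\mathcal{O}_{\mathrm{MVP}_n}(\Psi_{\mathrm{Sub}\to\mathrm{PF}}(S))=\pi$.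 $S$ is $\overrightarrow{P_2}$-free if there is no triple $i<j<k$ with $(i,j)\in S$ and $(j,k)\in S$. -}

module Defs where

open import Data.Nat using (ℕ; zero; suc)
open import Data.Bool using (Bool; true; false; _∧_; if_then_else_)
import Data.Bool.Properties as BoolP
open import Data.Fin using (Fin; _<_; _>_)
open import Data.Fin.Properties using (_<?_; _≟_; all?)
open import Data.Fin.Permutation using (Permutation′; _⟨$⟩ʳ_; _⟨$⟩ˡ_)
open import Data.Maybe using (Maybe; just; nothing; is-nothing; _>>=_)
import Data.Maybe as Maybe
import Data.Maybe.Properties as MaybeP
open import Data.Vec using (Vec; []; _∷_; lookup; replicate; tabulate; _[_]≔_)
import Data.Vec.Properties as VecP
open import Data.List using (List; []; _∷_; allFin; foldl; head; filterᵇ; filter; length; concatMap; map)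
open import Data.Product using (_×_)
open import Data.Empty using (⊥)
open import Relation.Nullary using (Dec; does; ¬_; ¬?)
open import Relation.Nullary.Decidable using (_×-dec_; _→-dec_)
open import Relation.Unary using (Pred; Decidable)
open import Relation.Binary.PropositionalEquality using (_≡_)

-- Spots and cars are 0-indexed: Fin n stands for [n].

-- A parking preference p ∈ [n]^n; lookup p c = preferred spot of car c.
Pref : ℕ → Set
Pref n = Vec (Fin n) n

-- Occupancy of the street: lookup occ s = just c iff car c sits in spot s.
Occ : ℕ → Set
Occ n = Vec (Maybe (Fin n)) n

emptyOcc : ∀ {n} → Occ n
emptyOcc = replicate _ nothing

firstFreeAfter : ∀ {n} → Occ n → Fin n → Maybe (Fin n)
firstFreeAfter {n} occ s =
  head (filterᵇ (λ k → does (s <? k) ∧ is-nothing (lookup occ k)) (allFin n))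

mvpStep : ∀ {n} → Pref n → Occ n → Fin n → Maybe (Occ n)
mvpStep p occ i with lookup occ (lookup p i)
... | nothing = just (occ [ lookup p i ]≔ just i)
... | just j with firstFreeAfter occ (lookup p i)
...   | nothing = nothing
...   | just k = just ((occ [ lookup p i ]≔ just i) [ k ]≔ just j)

mvpRun : ∀ {n} → Pref n → Maybe (Occ n)
mvpRun {n} p = foldl (λ mo i → mo >>= λ o → mvpStep p o i) (just emptyOcc) (allFin n)

readOff : ∀ {m n} → Vec (Maybe (Fin n)) m → Maybe (Vec (Fin n) m)
readOff [] = just []
readOff (nothing ∷ xs) = nothing
readOff (just c ∷ xs) = Maybe.map (c ∷_) (readOff xs)

IsMVP : ∀ {n} → Pref n → Set
IsMVP p = Maybe.Is-just (mvpRun p)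

outcome : ∀ {n} → Pref n → Maybe (Vec (Fin n) n)
outcome p = mvpRun p >>= readOff

-- the permutation π as the vector (π_1,…,π_n), π_i = car in spot i
permVec : ∀ {n} → Permutation′ n → Vec (Fin n) n
permVec π = tabulate (π ⟨$⟩ʳ_)

HasOutcome : ∀ {n} → Permutation′ n → Pref n → Set
HasOutcome π p = outcome p ≡ just (permVec π)

hasOutcome? : ∀ {n} (π : Permutation′ n) → Decidable (HasOutcome π)
hasOutcome? π p = MaybeP.≡-dec (VecP.≡-dec _≟_) (outcome p) (just (permVec π))

-- A set S of pairs (j,i) ∈ [n]×[n], as a Boolean matrix:
-- (j,i) ∈ S iff lookup (lookup S j) i ≡ true.
PairSet : ℕ → Set
PairSet n = Vec (Vec Bool n) n

_∈S_ : ∀ {n} → Fin n × Fin n → PairSet n → Set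
(j Data.Product., i) ∈S S = lookup (lookup S j) i ≡ true

open Data.Product using (_,_)

InInv : ∀ {n} → Permutation′ n → Fin n → Fin n → Set
InInv π j i = (j < i) × (π ⟨$⟩ʳ j > π ⟨$⟩ʳ i)

IsSub : ∀ {n} → Permutation′ n → PairSet n → Set
IsSub π S =
  (∀ j i → (j , i) ∈S S → InInv π j i) ×
  (∀ i j j′ → (j , i) ∈S S → (j′ , i) ∈S S → j ≡ j′)

-- Ψ_{Sub→PF}(S): p_{π_i} = j if (j,i) ∈ S, and p_{π_i} = i otherwise.
-- (For S ∈ Sub(π) the j is unique; we take the first one found.)
parentOf : ∀ {n} → PairSet n → Fin n → Maybe (Fin n)
parentOf {n} S i = head (filterᵇ (λ j → lookup (lookup S j) i) (allFin n))

Ψ : ∀ {n} → Permutation′ n → PairSet n → Pref n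
Ψ π S = tabulate λ c → Maybe.fromMaybe (π ⟨$⟩ˡ c) (parentOf S (π ⟨$⟩ˡ c))

Valid : ∀ {n} → Permutation′ n → PairSet n → Set
Valid π S = HasOutcome π (Ψ π S)

P2Free : ∀ {n} → PairSet n → Set
P2Free S = ∀ i j k → i < j → j < k → (i , j) ∈S S → (j , k) ∈S S → ⊥

private
  ∈S? : ∀ {n} (S : PairSet n) j i → Dec ((j , i) ∈S S)
  ∈S? S j i = lookup (lookup S j) i BoolP.≟ true

isSub? : ∀ {n} (π : Permutation′ n) → Decidable (IsSub π)
isSub? π S =
  all? (λ j → all? (λ i → ∈S? S j i →-dec ((j <? i) ×-dec ((π ⟨$⟩ʳ i) <? (π ⟨$⟩ʳ j)))))
  ×-dec
  all? (λ i → all? (λ j → all? (λ j′ → ∈S? S j i →-dec (∈S? S j′ i →-dec (j ≟ j′)))))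

p2Free? : ∀ {n} → Decidable (P2Free {n})
p2Free? S =
  all? λ i → all? λ j → all? λ k →
    (i <? j) →-dec ((j <? k) →-dec (∈S? S i j →-dec (∈S? S j k →-dec (Relation.Nullary.Decidable.no (λ ())))))
  where import Relation.Nullary.Decidable

subP2Free? : ∀ {n} (π : Permutation′ n) → Decidable (λ S → IsSub π S × P2Free S)
subP2Free? π S = isSub? π S ×-dec p2Free? S

allVecs : ∀ {A : Set} (m : ℕ) → List A → List (Vec A m)
allVecs zero xs = [] ∷ []
allVecs (suc m) xs = concatMap (λ x → map (x ∷_) (allVecs m xs)) xs

allPrefs : (n : ℕ) → List (Pref n)
allPrefs n = allVecs n (allFin n)

allPairSets : (n : ℕ) → List (PairSet n)
allPairSets n = allVecs n (allVecs n (true ∷ false ∷ []))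

preimageSize : ∀ {n} → Permutation′ n → ℕ
preimageSize {n} π = length (filter (hasOutcome? π) (allPrefs n))

p2FreeSubCount : ∀ {n} → Permutation′ n → ℕ
p2FreeSubCount {n} π = length (filter (subP2Free? π) (allPairSets n))

-- Two invariants of the MVP process drive everything.  A car never parks left of its
-- preference, and the spot a car c prefers ends up holding c itself or a later car
-- with the same preference.  If Ψ(S) has outcome π and (i,j), (j,k) ∈ S, then the car
-- π_k prefers spot j, which holds π_j; by the second invariant π_j = π_k or π_j shares
-- the preference j of π_k, contradicting i < j < k.  Conversely every p with outcome π
-- is Ψ(S) for S = {(p_{π_i}, i) : p_{π_i} ≠ i}, which the invariants put in Sub(π); so
-- p ↦ S injects O⁻¹(π) into the valid, hence P⃗₂-free, members of Sub(π).
module Submission where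

open import Defs
open import Data.Bool using (Bool; true; false; _∧_)
open import Data.Empty using (⊥)
open import Data.Fin using (Fin; toℕ; _<_; _≤_)
import Data.Fin as Fin
open import Data.Fin.Permutation using (Permutation′; _⟨$⟩ʳ_; _⟨$⟩ˡ_; inverseˡ; inverseʳ)
open import Data.Fin.Properties using (_≟_; _<?_; ≤-refl; <⇒≢; ≤∧≢⇒<; toℕ<n)
open import Data.List using (List; []; _∷_; length; map; concatMap; _++_; cartesianProductWith; filter; filterᵇ; head; foldl; allFin)
import Data.List as List
open import Data.List.Membership.Propositional using (_∈_)
open import Data.List.Membership.Propositional.Properties using (∈-allFin; ∈-filter⁺; ∈-filter⁻; ∈-cartesianProductWith⁺)
import Data.List.Relation.Unary.All as All
open import Data.List.Relation.Unary.AllPairs using ([]; _∷_)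
open import Data.List.Relation.Unary.Any using (here; there; _─_)
open import Data.List.Relation.Unary.Unique.Propositional using (Unique)
open import Data.List.Relation.Unary.Unique.Propositional.Properties using (filter⁺; cartesianProductWith⁺; allFin⁺)
open import Data.Maybe using (Maybe; just; nothing; is-nothing; fromMaybe; _>>=_)
open import Data.Maybe.Properties using (just-injective)
open import Data.Nat using (ℕ; zero; suc; _+_; z≤n; s≤s)
import Data.Nat as ℕ
import Data.Nat.Properties as ℕ
open import Data.Product using (_×_; _,_; proj₁; proj₂; ∃)
open import Data.Sum using (_⊎_; inj₁; inj₂)
import Data.Sum as Sum
open import Data.Vec using (Vec; []; _∷_; lookup; tabulate; _[_]≔_)
open import Data.Vec.Properties using (∷-injective; lookup∘update; lookup∘update′; lookup-replicate; lookup∘tabulate; tabulate∘lookup; tabulate-cong)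
open import Function using (Injection; Equivalence; _⇔_; mk⇔)
open import Function.Properties.Inverse using (↔⇒↣)
open import Level using (0ℓ)
open import Relation.Nullary using (Dec; yes; no; does; ¬_; ¬?; contradiction)
open import Relation.Nullary.Decidable using (_×-dec_; dec-true)
open import Relation.Unary using (Pred; Decidable)
open import Relation.Binary.PropositionalEquality using (_≡_; _≢_; refl; sym; trans; cong; subst; module ≡-Reasoning)

private variable
  A B : Set

length-─ : ∀ {x : A} {xs} (x∈xs : x ∈ xs) → length xs ≡ suc (length (xs ─ x∈xs))
length-─ (here refl) = refl
length-─ {xs = _ ∷ _} (there x∈xs) = cong suc (length-─ x∈xs)

∈-─⁺ : ∀ {x y : A} {xs} (x∈xs : x ∈ xs) → y ∈ xs → y ≢ x → y ∈ (xs ─ x∈xs)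
∈-─⁺ (here refl) (here y≡x) y≢x = contradiction y≡x y≢x
∈-─⁺ (here refl) (there y∈xs) _ = y∈xs
∈-─⁺ (there _) (here y≡x) _ = here y≡x
∈-─⁺ (there x∈xs) (there y∈xs) y≢x = there (∈-─⁺ x∈xs y∈xs y≢x)

length-≤-injection : (f : A → B) {xs : List A} {ys : List B} → Unique xs →
  (∀ {x} → x ∈ xs → f x ∈ ys) →
  (∀ {x y} → x ∈ xs → y ∈ xs → f x ≡ f y → x ≡ y) →
  length xs ℕ.≤ length ys
length-≤-injection f {[]} _ _ _ = z≤n
length-≤-injection f {x ∷ xs} {ys} (x∉xs ∷ xs!) into inj
  rewrite length-─ (into (here refl)) =
  s≤s (length-≤-injection f xs! into′ (λ a b → inj (there a) (there b)))
  where
  into′ : ∀ {y} → y ∈ xs → f y ∈ (ys ─ into (here refl))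
  into′ y∈xs = ∈-─⁺ (into (here refl)) (into (there y∈xs))
    (λ fy≡fx → All.lookup x∉xs y∈xs (sym (inj (there y∈xs) (here refl) fy≡fx)))

length-filter-≤-injection : {P : Pred A 0ℓ} {Q : Pred B 0ℓ} (P? : Decidable P) (Q? : Decidable Q)
  (f : A → B) {xs : List A} {ys : List B} → Unique xs →
  (∀ {x} → P x → Q (f x)) → (∀ {x} → P x → f x ∈ ys) →
  (∀ {x y} → P x → P y → f x ≡ f y → x ≡ y) →
  length (filter P? xs) ℕ.≤ length (filter Q? ys)
length-filter-≤-injection P? Q? f {xs} xs! preserves into inj =
  length-≤-injection f (filter⁺ P? xs!)
    (λ x∈ → let Px = proj₂ (∈-filter⁻ P? {xs = xs} x∈) in ∈-filter⁺ Q? (into Px) (preserves Px))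
    (λ x∈ y∈ → inj (proj₂ (∈-filter⁻ P? {xs = xs} x∈)) (proj₂ (∈-filter⁻ P? {xs = xs} y∈)))

concatMap-map≡cartesianProductWith : {C : Set} (f : A → B → C) (xs : List A) (ys : List B) →
  concatMap (λ x → map (f x) ys) xs ≡ cartesianProductWith f xs ys
concatMap-map≡cartesianProductWith f [] ys = refl
concatMap-map≡cartesianProductWith f (x ∷ xs) ys =
  cong (map (f x) ys ++_) (concatMap-map≡cartesianProductWith f xs ys)

allVecs-suc : ∀ m (xs : List A) → allVecs (suc m) xs ≡ cartesianProductWith _∷_ xs (allVecs m xs)
allVecs-suc m xs = concatMap-map≡cartesianProductWith _∷_ xs (allVecs m xs)

∈-allVecs : {xs : List A} → (∀ x → x ∈ xs) → ∀ {m} (v : Vec A m) → v ∈ allVecs m xs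
∈-allVecs complete [] = here refl
∈-allVecs {xs = xs} complete {suc m} (x ∷ v) =
  subst ((x ∷ v) ∈_) (sym (allVecs-suc m xs))
    (∈-cartesianProductWith⁺ _∷_ (complete x) (∈-allVecs complete v))

allVecs⁺ : {xs : List A} → Unique xs → ∀ m → Unique (allVecs m xs)
allVecs⁺ xs! zero = All.[] ∷ []
allVecs⁺ {xs = xs} xs! (suc m) =
  subst Unique (sym (allVecs-suc m xs)) (cartesianProductWith⁺ _∷_ ∷-injective xs! (allVecs⁺ xs! m))

head-filterᵇ-just : (g : A → Bool) (xs : List A) {k : A} →
  head (filterᵇ g xs) ≡ just k → g k ≡ true
head-filterᵇ-just g (x ∷ xs) eq with g x in gx
... | true with refl ← eq = gx
... | false = head-filterᵇ-just g xs eq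

head-filterᵇ-unique : (g : A → Bool) (xs : List A) {k : A} → k ∈ xs → g k ≡ true →
  (∀ y → g y ≡ true → y ≡ k) → head (filterᵇ g xs) ≡ just k
head-filterᵇ-unique g (x ∷ xs) k∈ gk only-k with g x in gx
... | true = cong just (only-k x gx)
head-filterᵇ-unique g (x ∷ xs) (here refl) gk only-k | false with () ← trans (sym gx) gk
head-filterᵇ-unique g (x ∷ xs) (there k∈) gk only-k | false = head-filterᵇ-unique g xs k∈ gk only-k

head-filterᵇ-none : (g : A → Bool) (xs : List A) → (∀ y → g y ≢ true) → head (filterᵇ g xs) ≡ nothing
head-filterᵇ-none g [] _ = refl
head-filterᵇ-none g (x ∷ xs) none with g x in gx
... | true = contradiction gx (none x)
... | false = head-filterᵇ-none g xs none

does-true : (a? : Dec A) → does a? ≡ true → A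
does-true (yes a) _ = a
does-true (no _) ()

∧-true : ∀ x {y} → x ∧ y ≡ true → x ≡ true × y ≡ true
∧-true true y≡true = refl , y≡true

is-nothing-true : (m : Maybe A) → is-nothing m ≡ true → m ≡ nothing
is-nothing-true nothing _ = refl

firstFreeAfter-just : ∀ {n} {o : Occ n} {s k} → firstFreeAfter o s ≡ just k →
  s < k × lookup o k ≡ nothing
firstFreeAfter-just {n} {o} {s} {k} eq
  with s<k , k-free ← ∧-true (does (s <? k)) (head-filterᵇ-just _ (allFin n) eq) =
  does-true (s <? k) s<k , is-nothing-true (lookup o k) k-free

module _ {State : Set} {n : ℕ} (step : State → Fin n → Maybe State) (I : ℕ → State → Set)
  (preserves : ∀ {k b b′} x → toℕ x ≡ k → I k b → step b x ≡ just b′ → I (suc k) b′) where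

  private
    step? : Maybe State → Fin n → Maybe State
    step? mb x = mb >>= λ b → step b x

    foldl-nothing : ∀ xs → foldl step? nothing xs ≡ nothing
    foldl-nothing [] = refl
    foldl-nothing (_ ∷ xs) = foldl-nothing xs

  foldl-tabulate-invariant : ∀ {m} k (f : Fin m → Fin n) → (∀ i → toℕ (f i) ≡ k + toℕ i) →
    ∀ {b b′} → I k b → foldl step? (just b) (List.tabulate f) ≡ just b′ → I (k + m) b′
  foldl-tabulate-invariant {zero} k f _ {b′ = b′} Ib refl = subst (λ k → I k b′) (sym (ℕ.+-identityʳ k)) Ib
  foldl-tabulate-invariant {suc m} k f position {b} {b′} Ib eq with step b (f Fin.zero) in stepped
  ... | nothing = contradiction (trans (sym (foldl-nothing (List.tabulate (λ i → f (Fin.suc i))))) eq) λ ()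
  ... | just b₁ = subst (λ k → I k b′) (sym (ℕ.+-suc k m))
    (foldl-tabulate-invariant (suc k) (λ i → f (Fin.suc i))
      (λ i → trans (position (Fin.suc i)) (ℕ.+-suc k (toℕ i)))
      (preserves (f Fin.zero) (trans (position Fin.zero) (ℕ.+-identityʳ k)) Ib stepped)
      eq)

  foldl-allFin-invariant : ∀ {b b′} → I 0 b → foldl step? (just b) (allFin n) ≡ just b′ → I n b′
  foldl-allFin-invariant = foldl-tabulate-invariant 0 (λ i → i) (λ _ → refl)

module _ {n : ℕ} (p : Pref n) where

  Supersedes : Fin n → Fin n → Set
  Supersedes d c = d ≡ c ⊎ (c < d × lookup p d ≡ lookup p c)

  BumpedInto : Occ n → Occ n → Fin n → Fin n → Set
  BumpedInto o o′ x t =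
    lookup p x < t × lookup o t ≡ nothing ×
    ∃ λ j → lookup o (lookup p x) ≡ just j × lookup o′ t ≡ just j

  mvpStep-effect : ∀ {o o′ x} → mvpStep p o x ≡ just o′ →
    lookup o′ (lookup p x) ≡ just x ×
    (∀ t → t ≢ lookup p x → lookup o′ t ≡ lookup o t ⊎ BumpedInto o o′ x t)
  mvpStep-effect {o} {x = x} _ with lookup o (lookup p x)
  mvpStep-effect {o} {x = x} refl | nothing =
    lookup∘update (lookup p x) o (just x) , λ t t≢ → inj₁ (lookup∘update′ t≢ o (just x))
  ... | just j with firstFreeAfter o (lookup p x) in free
  mvpStep-effect () | just j | nothing
  mvpStep-effect {o} {x = x} refl | just j | just k =
    parks , λ t t≢Px → Sum.map₂ (λ (Px<t , t-free , o′t) → Px<t , t-free , j , refl , o′t) (moved t t≢Px)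
    where
    o₁ : Occ n
    o₁ = o [ lookup p x ]≔ just x
    Px<k : lookup p x < k
    Px<k = proj₁ (firstFreeAfter-just {o = o} free)

    parks : lookup (o₁ [ k ]≔ just j) (lookup p x) ≡ just x
    parks = trans (lookup∘update′ (<⇒≢ Px<k) o₁ (just j)) (lookup∘update (lookup p x) o (just x))

    moved : ∀ t → t ≢ lookup p x → lookup (o₁ [ k ]≔ just j) t ≡ lookup o t ⊎
      (lookup p x < t × lookup o t ≡ nothing × lookup (o₁ [ k ]≔ just j) t ≡ just j)
    moved t t≢Px with t ≟ k
    ... | yes refl = inj₂ (Px<k , proj₂ (firstFreeAfter-just {o = o} free) , lookup∘update k o₁ (just j))
    ... | no t≢k = inj₁ (trans (lookup∘update′ t≢k o₁ (just j)) (lookup∘update′ t≢Px o (just x)))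

  ParkedAtOrAfterPreference : Occ n → Set
  ParkedAtOrAfterPreference o = ∀ s d → lookup o s ≡ just d → lookup p d ≤ s

  PreferredSpotsSuperseded : ℕ → Occ n → Set
  PreferredSpotsSuperseded k o =
    ∀ c → toℕ c ℕ.< k → ∃ λ d → lookup o (lookup p c) ≡ just d × Supersedes d c

  mvpStep-parkedAtOrAfterPreference : ∀ {o o′ x} → mvpStep p o x ≡ just o′ →
    ParkedAtOrAfterPreference o → ParkedAtOrAfterPreference o′
  mvpStep-parkedAtOrAfterPreference {o} {x = x} eq parked t d o′t
    with parks , others ← mvpStep-effect {o} eq | t ≟ lookup p x
  ... | yes refl with refl ← trans (sym o′t) parks = ≤-refl
  ... | no t≢Px with others t t≢Px
  ...   | inj₁ unchanged = parked t d (trans (sym unchanged) o′t)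
  ...   | inj₂ (Px<t , _ , j , oPx , o′t≡j) with refl ← trans (sym o′t) o′t≡j =
    ℕ.<⇒≤ (ℕ.≤-<-trans (parked (lookup p x) j oPx) Px<t)

  mvpStep-preferredSpotsSuperseded : ∀ {o o′ x} → mvpStep p o x ≡ just o′ →
    PreferredSpotsSuperseded (toℕ x) o → PreferredSpotsSuperseded (suc (toℕ x)) o′
  mvpStep-preferredSpotsSuperseded {o} {o′} {x} eq held c c≤x
    with parks , others ← mvpStep-effect {o} eq | c ≟ x
  ... | yes refl = x , parks , inj₁ refl
  ... | no c≢x with ≤∧≢⇒< (ℕ.≤-pred c≤x) c≢x
  ...   | c<x with d , od , d-sup ← held c c<x | lookup p c ≟ lookup p x
  ...     | yes same = x , trans (cong (lookup o′) same) parks , inj₂ (c<x , sym same)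
  ...     | no differ with others (lookup p c) differ
  ...       | inj₁ unchanged = d , trans unchanged od , d-sup
  ...       | inj₂ (_ , empty , _) = contradiction (trans (sym empty) od) λ ()

  mvpRun-invariant : ∀ {o} → mvpRun p ≡ just o →
    ParkedAtOrAfterPreference o × PreferredSpotsSuperseded n o
  mvpRun-invariant = foldl-allFin-invariant (mvpStep p)
    (λ k o → ParkedAtOrAfterPreference o × PreferredSpotsSuperseded k o)
    (λ { {b = o} _ refl (parked , held) eq →
         mvpStep-parkedAtOrAfterPreference {o} eq parked , mvpStep-preferredSpotsSuperseded {o} eq held })
    ((λ s d empty → contradiction (trans (sym (lookup-replicate s nothing)) empty) λ ()) , λ _ ())

readOff-lookup : ∀ {m n} (v : Vec (Maybe (Fin n)) m) {w} → readOff v ≡ just w →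
  ∀ s → lookup v s ≡ just (lookup w s)
readOff-lookup (just c ∷ v) eq s with readOff v in rest
readOff-lookup (just c ∷ v) refl Fin.zero | just w = refl
readOff-lookup (just c ∷ v) refl (Fin.suc s) | just w = readOff-lookup v rest s

∈-allPairSets : ∀ {n} (S : PairSet n) → S ∈ allPairSets n
∈-allPairSets = ∈-allVecs (∈-allVecs λ { true → here refl ; false → there (here refl) })

module _ {n : ℕ} (π : Permutation′ n) where

  private
    πʳ-injective : ∀ {i j} → π ⟨$⟩ʳ i ≡ π ⟨$⟩ʳ j → i ≡ j
    πʳ-injective = Injection.injective (↔⇒↣ π)

  hasOutcome-invariant : ∀ {p} → HasOutcome π p → ∃ λ o →
    ParkedAtOrAfterPreference p o × PreferredSpotsSuperseded p n o ×
    (∀ s → lookup o s ≡ just (π ⟨$⟩ʳ s))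
  hasOutcome-invariant {p} has with mvpRun p in run
  ... | just o with parked , held ← mvpRun-invariant p run =
    o , parked , held , λ s → trans (readOff-lookup o has s) (cong just (lookup∘tabulate (π ⟨$⟩ʳ_) s))

  hasOutcome-parked : ∀ {p} → HasOutcome π p → ∀ s → lookup p (π ⟨$⟩ʳ s) ≤ s
  hasOutcome-parked has s with _ , parked , _ , final ← hasOutcome-invariant has =
    parked s (π ⟨$⟩ʳ s) (final s)

  hasOutcome-supersedes : ∀ {p} → HasOutcome π p → ∀ c → Supersedes p (π ⟨$⟩ʳ lookup p c) c
  hasOutcome-supersedes {p} has c
    with _ , _ , held , final ← hasOutcome-invariant has
    with d , od , d-sup ← held c (toℕ<n c)
    with refl ← just-injective (trans (sym od) (final (lookup p c))) = d-sup

  lookup-Ψ : ∀ S i → lookup (Ψ π S) (π ⟨$⟩ʳ i) ≡ fromMaybe i (parentOf S i)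
  lookup-Ψ S i = trans (lookup∘tabulate _ (π ⟨$⟩ʳ i)) (cong (λ i → fromMaybe i (parentOf S i)) (inverseˡ π))

  lookup-Ψ-parent : ∀ S {i j} → (∀ j′ → (j′ , i) ∈S S → j′ ≡ j) → (j , i) ∈S S →
    lookup (Ψ π S) (π ⟨$⟩ʳ i) ≡ j
  lookup-Ψ-parent S {i} {j} only-j ji∈S = trans (lookup-Ψ S i)
    (cong (fromMaybe i) (head-filterᵇ-unique _ (allFin n) (∈-allFin j) ji∈S only-j))

  lookup-Ψ-orphan : ∀ S {i} → (∀ j → ¬ (j , i) ∈S S) → lookup (Ψ π S) (π ⟨$⟩ʳ i) ≡ i
  lookup-Ψ-orphan S {i} orphan = trans (lookup-Ψ S i) (cong (fromMaybe i) (head-filterᵇ-none _ (allFin n) orphan))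

  valid⇒P2Free : (S : PairSet n) → IsSub π S → Valid π S → P2Free S
  valid⇒P2Free S (_ , one-parent) valid i j k i<j j<k ij∈S jk∈S =
    impossible (subst (λ s → Supersedes (Ψ π S) (π ⟨$⟩ʳ s) (π ⟨$⟩ʳ k)) pk
                      (hasOutcome-supersedes valid (π ⟨$⟩ʳ k)))
    where
    pj : lookup (Ψ π S) (π ⟨$⟩ʳ j) ≡ i
    pj = lookup-Ψ-parent S (λ j′ j′j∈S → one-parent j j′ i j′j∈S ij∈S) ij∈S
    pk : lookup (Ψ π S) (π ⟨$⟩ʳ k) ≡ j
    pk = lookup-Ψ-parent S (λ j′ j′k∈S → one-parent k j′ j j′k∈S jk∈S) jk∈S

    impossible : Supersedes (Ψ π S) (π ⟨$⟩ʳ j) (π ⟨$⟩ʳ k) → ⊥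
    impossible (inj₁ same-car) = <⇒≢ j<k (πʳ-injective same-car)
    impossible (inj₂ (_ , same-preference)) = <⇒≢ i<j (trans (sym pj) (trans same-preference pk))

  subOf : Pref n → PairSet n
  subOf p = tabulate λ j → tabulate λ i → does ((lookup p (π ⟨$⟩ʳ i) ≟ j) ×-dec ¬? (j ≟ i))

  ∈S-subOf : ∀ p {j i} → (j , i) ∈S subOf p ⇔ (lookup p (π ⟨$⟩ʳ i) ≡ j × j ≢ i)
  ∈S-subOf p {j} {i} = mk⇔
    (λ ji∈S → does-true decision (trans (sym entry) ji∈S))
    (λ parent → trans entry (dec-true decision parent))
    where
    decision = (lookup p (π ⟨$⟩ʳ i) ≟ j) ×-dec ¬? (j ≟ i)
    entry : lookup (lookup (subOf p) j) i ≡ does decision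
    entry = trans (cong (λ row → lookup row i) (lookup∘tabulate _ j)) (lookup∘tabulate _ i)

  Ψ-subOf : ∀ p → Ψ π (subOf p) ≡ p
  Ψ-subOf p = begin
    Ψ π (subOf p)                      ≡⟨ tabulate∘lookup (Ψ π (subOf p)) ⟨
    tabulate (lookup (Ψ π (subOf p)))  ≡⟨ tabulate-cong pointwise ⟩
    tabulate (lookup p)                ≡⟨ tabulate∘lookup p ⟩
    p                                  ∎
    where
    open ≡-Reasoning
    lookup-Ψ-subOf : ∀ i → lookup (Ψ π (subOf p)) (π ⟨$⟩ʳ i) ≡ lookup p (π ⟨$⟩ʳ i)
    lookup-Ψ-subOf i with lookup p (π ⟨$⟩ʳ i) ≟ i
    ... | yes stays = trans (lookup-Ψ-orphan (subOf p)
            λ j ji∈S → let pi≡j , j≢i = Equivalence.to (∈S-subOf p) ji∈S in j≢i (trans (sym pi≡j) stays))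
          (sym stays)
    ... | no moves = lookup-Ψ-parent (subOf p)
            (λ j′ j′i∈S → sym (proj₁ (Equivalence.to (∈S-subOf p) j′i∈S)))
            (Equivalence.from (∈S-subOf p) (refl , moves))

    pointwise : ∀ c → lookup (Ψ π (subOf p)) c ≡ lookup p c
    pointwise c = subst (λ c → lookup (Ψ π (subOf p)) c ≡ lookup p c) (inverseʳ π) (lookup-Ψ-subOf (π ⟨$⟩ˡ c))

  subOf-isSub : ∀ {p} → HasOutcome π p → IsSub π (subOf p)
  subOf-isSub {p} has = inversion , one-parent
    where
    inversion : ∀ j i → (j , i) ∈S subOf p → InInv π j i
    inversion j i ji∈S with refl , j≢i ← Equivalence.to (∈S-subOf p) ji∈S =
      ≤∧≢⇒< (hasOutcome-parked has i) j≢i , later (hasOutcome-supersedes has (π ⟨$⟩ʳ i))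
      where
      later : Supersedes p (π ⟨$⟩ʳ j) (π ⟨$⟩ʳ i) → π ⟨$⟩ʳ i < π ⟨$⟩ʳ j
      later (inj₁ same-car) = contradiction (πʳ-injective same-car) j≢i
      later (inj₂ (πi<πj , _)) = πi<πj
    one-parent : ∀ i j j′ → (j , i) ∈S subOf p → (j′ , i) ∈S subOf p → j ≡ j′
    one-parent i j j′ ji∈S j′i∈S =
      trans (sym (proj₁ (Equivalence.to (∈S-subOf p) ji∈S))) (proj₁ (Equivalence.to (∈S-subOf p) j′i∈S))

  subOf-valid : ∀ {p} → HasOutcome π p → Valid π (subOf p)
  subOf-valid {p} has = subst (HasOutcome π) (sym (Ψ-subOf p)) has

proposition2p12 : (n : ℕ) (π : Permutation′ n) →
    ((S : PairSet n) → IsSub π S → Valid π S → P2Free S) ×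
    (preimageSize π ℕ.≤ p2FreeSubCount π)
proposition2p12 n π = valid⇒P2Free π ,
  length-filter-≤-injection (hasOutcome? π) (subP2Free? π) (subOf π)
    (allVecs⁺ (allFin⁺ n) n)
    (λ {p} has → subOf-isSub π has , valid⇒P2Free π (subOf π p) (subOf-isSub π has) (subOf-valid π has))
    (λ _ → ∈-allPairSets _)
    (λ {p} {q} _ _ same-sub → begin
      p                 ≡⟨ Ψ-subOf π p ⟨
      Ψ π (subOf π p)   ≡⟨ cong (Ψ π) same-sub ⟩
      Ψ π (subOf π q)   ≡⟨ Ψ-subOf π q ⟩
      q                 ∎)
  where open ≡-Reasoning
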